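{- Let $N = q^k n^2$ be an odd perfect number given in Eulerian form. Define $H = \gcd(n^2,\sigma(n^2))$, $I = \gcd(n,\sigma(n^2))$ and $J = H/I$. If $\sigma(q^k)/2$ is squarefree, then $J \neq 1$.
   Context: $\sigma(x)$ denotes the sum of the positive divisors of $x$. A positive integer $N$ is perfect if $\sigma(N)=2N$. An odd perfect number $N$ is said to be given in Eulerian form $N = q^k n^2$ if $q$ is a prime (the special prime), $k$ and $n$ are positive integers, $q \equiv k \equiv 1 \pmod 4$, and $\gcd(q,n)=1$. -}

module Defs where

open import Data.Nat using (ℕ; suc; _+_; _*_; _^_; _%_; _≡ᵇ_; _<_)
open import Data.Nat.Divisibility using (_∣_)
open import Data.List using (List; filter; upTo; map)
open import Data.Nat.ListAction using (sum)
open import Data.Nat.Primality using (Prime)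
open import Data.Nat.GCD using (gcd)
open import Data.Product using (_×_)
open import Relation.Binary.PropositionalEquality using (_≡_)
open import Relation.Nullary using (¬_)
open import Data.Nat.Divisibility using (_∣?_)

divisors : ℕ → List ℕ
divisors x = filter (_∣? x) (map suc (upTo x))

σ : ℕ → ℕ
σ x = sum (divisors x)

Perfect : ℕ → Set
Perfect N = (0 < N) × (σ N ≡ 2 * N)

Squarefree : ℕ → Set
Squarefree m = ∀ d → 1 < d → ¬ ((d * d) ∣ m)

EulerianOPN : ℕ → ℕ → ℕ → ℕ → Set
EulerianOPN N q k n =
  Perfect N × (N % 2 ≡ 1) × (N ≡ q ^ k * (n * n)) × Prime q ×
  (0 < k) × (0 < n) × (q % 4 ≡ 1) × (k % 4 ≡ 1) × (gcd q n ≡ 1)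

-- Write s = σ(q^k)/2. Perfection gives s · σ(n²) = q^k n² with s prime to q, so n² = g s and
-- σ(n²) = q^k g, whence H = gcd(g s, g q^k) = g. If J = 1 then g = I divides n, and as s is squarefree
-- this forces n = g = s: so n is squarefree, σ(n²) = q^k n and σ(q^k) = 2n.
-- For squarefree n, σ(n²) is the product of the p² + p + 1 over the primes p ∣ n, and by Fermat's
-- little theorem every prime factor of x² + x + 1 is 3 or ≡ 1 (mod 3). The primes of n divide σ(n²),
-- and two distinct ones ≡ 1 (mod 3) would put 9 into σ(n²) = q^k n, hence into n. So n is 1, a prime
-- or 3p, and each case contradicts the two equations; n = 3p forces p = 13, q^k = 61 and σ(61) = 78.

module Submission where

open import Defs
open import Data.Empty using (⊥; ⊥-elim)
open import Data.Fin.Base using (Fin; toℕ; fromℕ; zero; suc)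
open import Data.Fin.Properties using (toℕ-inject₁; toℕ<n; toℕ-fromℕ)
open import Data.List using ([]; _∷_; map; upTo; _++_; cartesianProductWith)
open import Data.List.Membership.Propositional using (_∈_)
open import Data.List.Membership.Propositional.Properties
open import Data.List.Membership.Propositional.Properties.WithK using (unique∧set⇒bag)
open import Data.List.Relation.Binary.BagAndSetEquality using (∼bag⇒↭)
open import Data.List.Relation.Unary.All as All using (_∷_)
open import Data.List.Relation.Unary.Any using (here; there)
open import Data.List.Relation.Unary.Unique.Propositional using (Unique; []; _∷_)
import Data.List.Relation.Unary.Unique.Propositional.Properties as Unique
open import Data.Nat
open import Data.Nat.Coprimality as Coprime using (Coprime; coprime-divisor; coprime-/gcd)
open import Data.Nat.Combinatorics using (_C_; nCn≡1; k![n∸k]!∣n!)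
open import Data.Nat.Combinatorics.Specification using (nCk≡n!/k![n-k]!)
open import Data.Nat.Divisibility
open import Data.Nat.DivMod
open import Data.Nat.GCD using (gcd; gcd[m,n]∣m; gcd[m,n]∣n; c*gcd[m,n]≡gcd[cm,cn])
open import Data.Nat.Induction using (<-rec)
open import Data.Nat.LCM using (lcm; lcm-least; gcd*lcm)
open import Data.Nat.ListAction using (sum; product)
open import Data.Nat.ListAction.Properties using (sum-++; sum-↭)
open import Data.Nat.Primality
open import Data.Nat.Primality.Factorisation using (factorise)
open import Data.Nat.Properties
open import Data.Nat.Tactic.RingSolver using (solve-∀)
import Algebra.Definitions.RawMonoid +-0-rawMonoid as Additive
import Algebra.Definitions.RawMonoid *-1-rawMonoid as Multiplicative
import Algebra.Properties.CommutativeSemiring.Binomial +-*-commutativeSemiring as Binomial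
import Algebra.Properties.Monoid.Sum +-0-monoid as Sum
open import Data.Product using (_×_; _,_; proj₁; proj₂; ∃; ∃₂)
open import Data.Sum using (_⊎_; inj₁; inj₂; map₂)
open import Data.Unit using (tt)
open import Data.Vec.Functional using (Vector; tail; init; last)
open import Function.Base using (_∘_; case_of_)
open import Function.Bundles using (mk⇔)
open import Level using (0ℓ)
open import Relation.Binary.Bundles using (Setoid)
import Relation.Binary.Construct.On as On
open import Relation.Binary.Definitions using (tri<; tri≈; tri>)
open import Relation.Binary.PropositionalEquality
import Relation.Binary.Reasoning.Setoid as ≈-Reasoning
open import Relation.Nullary using (¬_; yes; no)
open import Relation.Nullary.Decidable using (toWitness)

private variable
  A B : Set
  a b d k m n p q r : ℕ

-- Divisor sums

>0-∣ : 0 < n → d ∣ n → 0 < d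
>0-∣ {d = zero} 0<n d∣n = ⊥-elim (<⇒≢ 0<n (sym (0∣⇒≡0 d∣n)))
>0-∣ {d = suc _} _ _ = z<s

∈-divisors⁻ : ∀ n → d ∈ divisors n → d ∣ n
∈-divisors⁻ n d∈ = proj₂ (∈-filter⁻ (_∣? n) {xs = map suc (upTo n)} d∈)

∈-divisors⁺ : 0 < n → d ∣ n → d ∈ divisors n
∈-divisors⁺ {n} {d} 0<n d∣n with >0-∣ 0<n d∣n
... | s≤s _ = ∈-filter⁺ (_∣? n) (∈-map⁺ suc (∈-upTo⁺ (∣⇒≤ {{>-nonZero 0<n}} d∣n))) d∣n

divisors-unique : ∀ n → Unique (divisors n)
divisors-unique n = Unique.filter⁺ (_∣? n) (Unique.map⁺ suc-injective (Unique.upTo⁺ n))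

sum-unique-⊆⊇ : ∀ {xs ys} → Unique xs → Unique ys →
  (∀ {z} → z ∈ xs → z ∈ ys) → (∀ {z} → z ∈ ys → z ∈ xs) → sum xs ≡ sum ys
sum-unique-⊆⊇ xs! ys! xs⊆ys ys⊆xs = sum-↭ (∼bag⇒↭ (unique∧set⇒bag xs! ys! (mk⇔ xs⊆ys ys⊆xs)))

Unique-map-injectiveOn : ∀ (f : A → B) {xs} → (∀ {x y} → x ∈ xs → y ∈ xs → f x ≡ f y → x ≡ y) →
  Unique xs → Unique (map f xs)
Unique-map-injectiveOn f {[]} _ [] = []
Unique-map-injectiveOn f {x ∷ xs} inj (x∉xs ∷ xs!) =
  All.tabulate fx∉ ∷ Unique-map-injectiveOn f (λ x∈ y∈ → inj (there x∈) (there y∈)) xs!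
  where
  fx∉ : ∀ {v} → v ∈ map f xs → f x ≢ v
  fx∉ v∈ fx≡v with ∈-map⁻ f v∈
  ... | y , y∈ , refl = All.lookup x∉xs y∈ (inj (here refl) (there y∈) fx≡v)

Unique-cartesianProductWith : ∀ {A B C : Set} (f : A → B → C) {xs ys} →
  (∀ {w x y z} → w ∈ xs → x ∈ xs → y ∈ ys → z ∈ ys → f w y ≡ f x z → w ≡ x × y ≡ z) →
  Unique xs → Unique ys → Unique (cartesianProductWith f xs ys)
Unique-cartesianProductWith f {[]} _ [] _ = []
Unique-cartesianProductWith f {x ∷ xs} {ys} inj (x∉xs ∷ xs!) ys! = Unique.++⁺
  (Unique-map-injectiveOn (f x) (λ y∈ z∈ e → proj₂ (inj (here refl) (here refl) y∈ z∈ e)) ys!)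
  (Unique-cartesianProductWith f (λ w∈ x∈ → inj (there w∈) (there x∈)) xs! ys!)
  disjoint
  where
  disjoint : ∀ {v} → ¬ (v ∈ map (f x) ys × v ∈ cartesianProductWith f xs ys)
  disjoint (v∈ , v∈′) with ∈-map⁻ (f x) v∈ | ∈-cartesianProductWith⁻ f xs ys v∈′
  ... | y , y∈ , refl | x′ , y′ , x′∈ , y′∈ , e =
    All.lookup x∉xs x′∈ (proj₁ (inj (here refl) (there x′∈) y∈ y′∈ e))

sum-map-* : ∀ n xs → sum (map (n *_) xs) ≡ n * sum xs
sum-map-* n [] = sym (*-zeroʳ n)
sum-map-* n (x ∷ xs) = trans (cong (n * x +_) (sum-map-* n xs)) (sym (*-distribˡ-+ n x (sum xs)))

sum-cartesianProductWith-* : ∀ xs ys → sum (cartesianProductWith _*_ xs ys) ≡ sum xs * sum ys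
sum-cartesianProductWith-* [] ys = refl
sum-cartesianProductWith-* (x ∷ xs) ys = begin
  sum (map (x *_) ys ++ cartesianProductWith _*_ xs ys)          ≡⟨ sum-++ (map (x *_) ys) _ ⟩
  sum (map (x *_) ys) + sum (cartesianProductWith _*_ xs ys)     ≡⟨ cong₂ _+_ (sum-map-* x ys) (sum-cartesianProductWith-* xs ys) ⟩
  x * sum ys + sum xs * sum ys                                    ≡⟨ *-distribʳ-+ (sum ys) x (sum xs) ⟨
  (x + sum xs) * sum ys                                           ∎
  where open ≡-Reasoning

∣-*-split : 0 < a → d ∣ a * b → ∃₂ λ d₁ d₂ → d₁ ∣ a × d₂ ∣ b × d ≡ d₁ * d₂
∣-*-split {a} {d} {b} 0<a d∣ab = g , d / g , gcd[m,n]∣n d a , d/g∣b , sym d≡g*[d/g]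
  where
  g = gcd d a
  instance _ = >-nonZero (>0-∣ 0<a (gcd[m,n]∣n d a))
  d≡g*[d/g] : g * (d / g) ≡ d
  d≡g*[d/g] = m*[n/m]≡n (gcd[m,n]∣m d a)
  d/g∣[a/g]*b : d / g ∣ a / g * b
  d/g∣[a/g]*b = *-cancelˡ-∣ g (subst₂ _∣_ (sym d≡g*[d/g])
    (trans (cong (_* b) (sym (m*[n/m]≡n (gcd[m,n]∣n d a)))) (*-assoc g (a / g) b)) d∣ab)
  d/g∣b : d / g ∣ b
  d/g∣b = coprime-divisor (coprime-/gcd d a) d/g∣[a/g]*b

σ-* : Coprime a b → σ (a * b) ≡ σ a * σ b
σ-* {zero} coprime with Coprime.0-coprimeTo-m⇒m≡1 coprime
... | refl = refl
σ-* {suc _} {zero} coprime with Coprime.0-coprimeTo-m⇒m≡1 (Coprime.sym coprime)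
... | refl = refl
σ-* {a@(suc _)} {b@(suc _)} coprime = begin
  σ (a * b)                                           ≡⟨ sum-unique-⊆⊇ (divisors-unique (a * b)) products! ⊆products ⊇products ⟩
  sum (cartesianProductWith _*_ (divisors a) (divisors b)) ≡⟨ sum-cartesianProductWith-* (divisors a) (divisors b) ⟩
  σ a * σ b                                           ∎
  where
  open ≡-Reasoning
  products! : Unique (cartesianProductWith _*_ (divisors a) (divisors b))
  products! = Unique-cartesianProductWith _*_ injective (divisors-unique a) (divisors-unique b)
    where
    divides-other : ∀ {w x y z} → w ∈ divisors a → z ∈ divisors b → w * y ≡ x * z → w ∣ x
    divides-other {w} {x} {y} {z} w∈ z∈ wy≡xz = coprime-divisor
      (λ (i∣w , i∣z) → coprime (∣-trans i∣w (∈-divisors⁻ a w∈) , ∣-trans i∣z (∈-divisors⁻ b z∈)))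
      (subst (w ∣_) (trans wy≡xz (*-comm x z)) (m∣m*n y))
    injective : ∀ {w x y z} → w ∈ divisors a → x ∈ divisors a → y ∈ divisors b → z ∈ divisors b →
      w * y ≡ x * z → w ≡ x × y ≡ z
    injective {w} {x} {y} {z} w∈ x∈ y∈ z∈ wy≡xz = w≡x ,
      *-cancelˡ-≡ y z w {{>-nonZero (>0-∣ z<s (∈-divisors⁻ a w∈))}} (trans wy≡xz (cong (_* z) (sym w≡x)))
      where
      w≡x = ∣-antisym (divides-other w∈ z∈ wy≡xz) (divides-other x∈ y∈ (sym wy≡xz))
  ⊆products : ∀ {d} → d ∈ divisors (a * b) → d ∈ cartesianProductWith _*_ (divisors a) (divisors b)
  ⊆products d∈ with ∣-*-split {a = a} {b = b} z<s (∈-divisors⁻ (a * b) d∈)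
  ... | d₁ , d₂ , d₁∣a , d₂∣b , refl =
    ∈-cartesianProductWith⁺ _*_ {xs = divisors a} {ys = divisors b} (∈-divisors⁺ z<s d₁∣a) (∈-divisors⁺ z<s d₂∣b)
  ⊇products : ∀ {d} → d ∈ cartesianProductWith _*_ (divisors a) (divisors b) → d ∈ divisors (a * b)
  ⊇products d∈ with ∈-cartesianProductWith⁻ _*_ (divisors a) (divisors b) d∈
  ... | d₁ , d₂ , d₁∈ , d₂∈ , refl = ∈-divisors⁺ z<s (*-pres-∣ (∈-divisors⁻ a d₁∈) (∈-divisors⁻ b d₂∈))

-- Primes, coprimality and prime powers

prime⇒>1 : Prime p → 1 < p
prime⇒>1 {p} p-prime = nonTrivial⇒n>1 p {{prime⇒nonTrivial p-prime}}

prime⇒>0 : Prime p → 0 < p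
prime⇒>0 p-prime = <-trans z<s (prime⇒>1 p-prime)

prime[3] : Prime 3
prime[3] = toWitness {a? = prime? 3} tt

prime[13] : Prime 13
prime[13] = toWitness {a? = prime? 13} tt

∣prime⇒≡ : Prime p → 1 < d → d ∣ p → d ≡ p
∣prime⇒≡ p-prime 1<d d∣p with prime⇒irreducible p-prime d∣p
... | inj₁ refl = ⊥-elim (<-irrefl refl 1<d)
... | inj₂ d≡p  = d≡p

prime∤⇒coprime : Prime p → ¬ p ∣ n → Coprime p n
prime∤⇒coprime p-prime p∤n (i∣p , i∣n) with prime⇒irreducible p-prime i∣p
... | inj₁ i≡1 = i≡1
... | inj₂ refl = ⊥-elim (p∤n i∣n)

distinct-primes⇒coprime : Prime p → Prime q → p ≢ q → Coprime p q
distinct-primes⇒coprime p-prime q-prime p≢q = prime∤⇒coprime p-prime (p≢q ∘ ∣prime⇒≡ q-prime (prime⇒>1 p-prime))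

coprime-*ˡ : Coprime a n → Coprime b n → Coprime (a * b) n
coprime-*ˡ {a} {n} {b} a⊥n b⊥n (i∣ab , i∣n) = b⊥n (coprime-divisor i⊥a i∣ab , i∣n)
  where
  i⊥a : Coprime _ a
  i⊥a (j∣i , j∣a) = a⊥n (j∣a , ∣-trans j∣i i∣n)

coprime-^ˡ : ∀ k → Coprime a n → Coprime (a ^ k) n
coprime-^ˡ zero    _   = Coprime.1-coprimeTo _
coprime-^ˡ (suc k) a⊥n = coprime-*ˡ a⊥n (coprime-^ˡ k a⊥n)

coprime-∣⇒*∣ : Coprime a b → a ∣ n → b ∣ n → a * b ∣ n
coprime-∣⇒*∣ {a} {b} a⊥b a∣n b∣n = subst (_∣ _) lcm≡a*b (lcm-least a∣n b∣n)
  where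
  lcm≡a*b : lcm a b ≡ a * b
  lcm≡a*b = trans (sym (*-identityˡ (lcm a b))) (trans (cong (_* lcm a b) (sym (Coprime.coprime⇒gcd≡1 a⊥b))) (gcd*lcm a b))

∣p^[1+k]⇒ : Prime p → ∀ k → d ∣ p ^ suc k → d ≡ p ^ suc k ⊎ d ∣ p ^ k
∣p^[1+k]⇒ {p} {d} p-prime zero d∣p with prime⇒irreducible p-prime (subst (d ∣_) (*-identityʳ p) d∣p)
... | inj₁ refl = inj₂ ∣-refl
... | inj₂ refl = inj₁ (sym (*-identityʳ p))
∣p^[1+k]⇒ {p} {d} p-prime (suc k) d∣p^[2+k] with p ∣? d
... | no p∤d = inj₂ (coprime-divisor (Coprime.sym (prime∤⇒coprime p-prime p∤d)) d∣p^[2+k])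
... | yes (divides e refl) with ∣p^[1+k]⇒ p-prime k
      (*-cancelˡ-∣ p {{>-nonZero (prime⇒>0 p-prime)}} (subst (_∣ p ^ suc (suc k)) (*-comm e p) d∣p^[2+k]))
...   | inj₁ refl = inj₁ (*-comm (p ^ suc k) p)
...   | inj₂ e∣p^k = inj₂ (subst (e * p ∣_) (*-comm (p ^ k) p) (*-monoˡ-∣ p e∣p^k))

σ[p^[1+k]] : Prime p → ∀ k → σ (p ^ suc k) ≡ p ^ suc k + σ (p ^ k)
σ[p^[1+k]] {p} p-prime k = sym (sum-unique-⊆⊇ {xs = p ^ suc k ∷ divisors (p ^ k)} fresh (divisors-unique (p ^ suc k)) ⊆ ⊇)
  where
  0<p^ : ∀ j → 0 < p ^ j
  0<p^ j = m^n>0 p {{>-nonZero (prime⇒>0 p-prime)}} j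
  fresh : Unique (p ^ suc k ∷ divisors (p ^ k))
  fresh = All.tabulate (λ d∈ p^[1+k]≡d → <⇒≱ (^-monoʳ-< p (prime⇒>1 p-prime) (n<1+n k))
            (subst (_≤ p ^ k) (sym p^[1+k]≡d) (∣⇒≤ {{>-nonZero (0<p^ k)}} (∈-divisors⁻ (p ^ k) d∈))))
        ∷ divisors-unique (p ^ k)
  ⊆ : ∀ {d} → d ∈ p ^ suc k ∷ divisors (p ^ k) → d ∈ divisors (p ^ suc k)
  ⊆ (here refl) = ∈-divisors⁺ (0<p^ (suc k)) ∣-refl
  ⊆ (there d∈)  = ∈-divisors⁺ (0<p^ (suc k)) (∣n⇒∣m*n p (∈-divisors⁻ (p ^ k) d∈))
  ⊇ : ∀ {d} → d ∈ divisors (p ^ suc k) → d ∈ p ^ suc k ∷ divisors (p ^ k)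
  ⊇ d∈ with ∣p^[1+k]⇒ p-prime k (∈-divisors⁻ (p ^ suc k) d∈)
  ... | inj₁ d≡p^[1+k] = here d≡p^[1+k]
  ... | inj₂ d∣p^k = there (∈-divisors⁺ (0<p^ k) d∣p^k)

σ[p^k]≡1+tp : Prime p → ∀ k → ∃ λ t → σ (p ^ k) ≡ 1 + t * p
σ[p^k]≡1+tp p-prime zero = 0 , refl
σ[p^k]≡1+tp {p} p-prime (suc k) with σ[p^k]≡1+tp p-prime k
... | t , σ≡ = p ^ k + t , trans (σ[p^[1+k]] p-prime k) (trans (cong (p ^ suc k +_) σ≡) (lemma p (p ^ k) t))
  where
  lemma : ∀ p a t → p * a + (1 + t * p) ≡ 1 + (a + t) * p
  lemma = solve-∀

prime∤σ[p^k] : Prime p → ∀ k → ¬ p ∣ σ (p ^ k)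
prime∤σ[p^k] p-prime k p∣σ with σ[p^k]≡1+tp p-prime k
... | t , σ≡ = <⇒≢ (prime⇒>1 p-prime) (sym (∣1⇒≡1 (∣m+n∣m⇒∣n (subst (_ ∣_) (trans σ≡ (+-comm 1 _)) p∣σ) (n∣m*n t))))

∣σ[p^k]⇒coprime : Prime p → d ∣ σ (p ^ k) → Coprime d (p ^ k)
∣σ[p^k]⇒coprime {k = k} p-prime d∣σ =
  Coprime.sym (coprime-^ˡ k (prime∤⇒coprime p-prime λ p∣d → prime∤σ[p^k] p-prime k (∣-trans p∣d d∣σ)))

2∣σ[p^k] : Prime p → p % 2 ≡ 1 → k % 2 ≡ 1 → 2 ∣ σ (p ^ k)
2∣σ[p^k] {p} {k} p-prime p%2≡1 k%2≡1 = subst (λ i → 2 ∣ σ (p ^ i)) (sym k≡1+2u) (2∣σ[p^[1+2v]] u)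
  where
  u = k / 2
  k≡1+2u : k ≡ suc (u + u)
  k≡1+2u = trans (m≡m%n+[m/n]*n k 2) (cong₂ _+_ k%2≡1 (trans (*-comm u 2) (cong (u +_) (+-identityʳ u))))
  2∣p+1 : 2 ∣ p + 1
  2∣p+1 = divides (p / 2 + 1) (trans (cong (_+ 1) (trans (m≡m%n+[m/n]*n p 2) (cong (_+ p / 2 * 2) p%2≡1))) (lemma (p / 2)))
    where
    lemma : ∀ t → 1 + t * 2 + 1 ≡ (t + 1) * 2
    lemma = solve-∀
  2∣σ[p^[1+2v]] : ∀ v → 2 ∣ σ (p ^ suc (v + v))
  2∣σ[p^[1+2v]] zero =
    subst (2 ∣_) (sym (σ[p^[1+k]] p-prime 0)) (subst (λ x → 2 ∣ x + 1) (sym (*-identityʳ p)) 2∣p+1)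
  2∣σ[p^[1+2v]] (suc v) =
    subst (λ i → 2 ∣ σ (p ^ suc i)) (sym (+-suc (suc v) v)) (subst (2 ∣_) (sym σ≡) 2∣sum)
    where
    j = suc (v + v)
    σ≡ : σ (p ^ suc (suc j)) ≡ p ^ suc j * (p + 1) + σ (p ^ j)
    σ≡ = begin
      σ (p ^ suc (suc j))                            ≡⟨ σ[p^[1+k]] p-prime (suc j) ⟩
      p ^ suc (suc j) + σ (p ^ suc j)                ≡⟨ cong (p ^ suc (suc j) +_) (σ[p^[1+k]] p-prime j) ⟩
      p * p ^ suc j + (p ^ suc j + σ (p ^ j))        ≡⟨ lemma p (p ^ suc j) (σ (p ^ j)) ⟩
      p ^ suc j * (p + 1) + σ (p ^ j)                ∎
      where
      open ≡-Reasoning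
      lemma : ∀ p a s → p * a + (a + s) ≡ a * (p + 1) + s
      lemma = solve-∀
    2∣sum : 2 ∣ p ^ suc j * (p + 1) + σ (p ^ j)
    2∣sum = ∣m∣n⇒∣m+n (∣n⇒∣m*n (p ^ suc j) 2∣p+1) (2∣σ[p^[1+2v]] v)

σ[p²] : Prime p → σ (p * p) ≡ p * p + p + 1
σ[p²] {p} p-prime = begin
  σ (p * p)               ≡⟨ cong σ (cong (p *_) (*-identityʳ p)) ⟨
  σ (p ^ 2)               ≡⟨ σ[p^[1+k]] p-prime 1 ⟩
  p ^ 2 + σ (p ^ 1)       ≡⟨ cong (p ^ 2 +_) (σ[p^[1+k]] p-prime 0) ⟩
  p ^ 2 + (p ^ 1 + 1)     ≡⟨ lemma p ⟩
  p * p + p + 1           ∎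
  where
  open ≡-Reasoning
  lemma : ∀ p → p * (p * 1) + (p * 1 + 1) ≡ p * p + p + 1
  lemma = solve-∀

prime∤σ[p²] : Prime p → ¬ p ∣ σ (p * p)
prime∤σ[p²] {p} p-prime p∣σ = <⇒≢ (prime⇒>1 p-prime) (sym (∣1⇒≡1 (∣m+n∣m⇒∣n (subst (p ∣_) (σ[p²] p-prime) p∣σ) p∣p²+p)))
  where
  p∣p²+p : p ∣ p * p + p
  p∣p²+p = ∣m∣n⇒∣m+n (m∣m*n p) ∣-refl

3∣σ[p²] : Prime p → p % 3 ≡ 1 → 3 ∣ σ (p * p)
3∣σ[p²] {p} p-prime p%3≡1 = divides (1 + t * 3 + t * t * 3) (begin
  σ (p * p)                                      ≡⟨ σ[p²] p-prime ⟩
  p * p + p + 1                                  ≡⟨ cong (λ u → u * u + u + 1) p≡ ⟩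
  (1 + t * 3) * (1 + t * 3) + (1 + t * 3) + 1    ≡⟨ lemma t ⟩
  (1 + t * 3 + t * t * 3) * 3                    ∎)
  where
  open ≡-Reasoning
  t = p / 3
  p≡ : p ≡ 1 + t * 3
  p≡ = trans (m≡m%n+[m/n]*n p 3) (cong (_+ t * 3) p%3≡1)
  lemma : ∀ t → (1 + t * 3) * (1 + t * 3) + (1 + t * 3) + 1 ≡ (1 + t * 3 + t * t * 3) * 3
  lemma = solve-∀

-- Fermat's little theorem and the prime divisors of p² + p + 1

-- The library's binomial theorem is stated with the generic semiring operations _×_ and _^_.
×≡* : ∀ m n → m Additive.× n ≡ m * n
×≡* zero n = refl
×≡* (suc m) n = cong (n +_) (×≡* m n)

^≡^ : ∀ m n → n Multiplicative.× m ≡ m ^ n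
^≡^ m zero = refl
^≡^ m (suc n) = cong (m *_) (^≡^ m n)

∣-sum : ∀ {d n} (f : Vector ℕ n) → (∀ i → d ∣ f i) → d ∣ Additive.sum f
∣-sum {n = zero} f h = _ ∣0
∣-sum {n = suc n} f h = ∣m∣n⇒∣m+n (h zero) (∣-sum (tail f) (h ∘ suc))

prime∤! : Prime p → m < p → ¬ p ∣ m !
prime∤! {m = zero} p-prime _ p∣1 = <⇒≢ (prime⇒>1 p-prime) (sym (∣1⇒≡1 p∣1))
prime∤! {m = suc m} p-prime m<p p∣[1+m]! with euclidsLemma (suc m) (m !) p-prime p∣[1+m]!
... | inj₁ p∣1+m = <⇒≱ m<p (∣⇒≤ p∣1+m)
... | inj₂ p∣m! = prime∤! p-prime (<-trans (n<1+n m) m<p) p∣m!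

C*k!*[n-k]!≡n! : ∀ {n k} → k ≤ n → (n C k) * (k ! * (n ∸ k) !) ≡ n !
C*k!*[n-k]!≡n! {n} {k} k≤n = begin
  (n C k) * (k ! * (n ∸ k) !)                  ≡⟨ cong (_* (k ! * (n ∸ k) !)) (nCk≡n!/k![n-k]! k≤n) ⟩
  n ! / (k ! * (n ∸ k) !) * (k ! * (n ∸ k) !)  ≡⟨ m/n*n≡m (k![n∸k]!∣n! k≤n) ⟩
  n ! ∎
  where
  open ≡-Reasoning
  instance _ = k !* (n ∸ k) !≢0

prime∣C : Prime p → 0 < k → k < p → p ∣ p C k
prime∣C {zero} _ _ ()
prime∣C {p@(suc _)} {k} p-prime 0<k k<p
  with euclidsLemma (p C k) (k ! * (p ∸ k) !) p-prime (subst (p ∣_) (sym (C*k!*[n-k]!≡n! (<⇒≤ k<p))) (m∣m*n _))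
... | inj₁ p∣C = p∣C
... | inj₂ p∣k![p-k]! with euclidsLemma _ _ p-prime p∣k![p-k]!
...   | inj₁ p∣k! = ⊥-elim (prime∤! p-prime k<p p∣k!)
...   | inj₂ p∣[p-k]! = ⊥-elim (prime∤! p-prime (∸-monoʳ-< 0<k (<⇒≤ k<p)) p∣[p-k]!)

binomialTerm≡ : ∀ a n (k : Fin (suc n)) → Binomial.binomialTerm a 1 n k ≡ (n C toℕ k) * a ^ toℕ k
binomialTerm≡ a n k = begin
  (n C toℕ k) Additive.× (toℕ k Multiplicative.× a * (n ∸ toℕ k) Multiplicative.× 1)
    ≡⟨ ×≡* (n C toℕ k) _ ⟩
  (n C toℕ k) * (toℕ k Multiplicative.× a * (n ∸ toℕ k) Multiplicative.× 1)
    ≡⟨ cong₂ (λ u v → (n C toℕ k) * (u * v)) (^≡^ a (toℕ k)) (trans (^≡^ 1 (n ∸ toℕ k)) (^-zeroˡ (n ∸ toℕ k))) ⟩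
  (n C toℕ k) * (a ^ toℕ k * 1)
    ≡⟨ cong ((n C toℕ k) *_) (*-identityʳ (a ^ toℕ k)) ⟩
  (n C toℕ k) * a ^ toℕ k ∎
  where open ≡-Reasoning

freshmans-dream : Prime p → ∀ a → ∃ λ m → (a + 1) ^ p ≡ 1 + m * p + a ^ p
freshmans-dream {p@(suc n)} p-prime a = quotient middle∣ , (begin
  (a + 1) ^ p                                 ≡⟨ ^≡^ (a + 1) p ⟨
  p Multiplicative.× (a + 1)                  ≡⟨ Binomial.theorem p a 1 ⟩
  Additive.sum (Binomial.binomialTerm a 1 p)  ≡⟨ Sum.sum-cong-≗ (binomialTerm≡ a p) ⟩
  1 + Additive.sum (tail term)                ≡⟨ cong (1 +_) (Sum.sum-init-last (tail term)) ⟩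
  1 + (Additive.sum middle + last (tail term)) ≡⟨ cong₂ (λ u v → 1 + (u + v)) (m∣n⇒n≡quotient*m middle∣) last≡ ⟩
  1 + (quotient middle∣ * p + a ^ p)          ≡⟨ +-assoc 1 (quotient middle∣ * p) (a ^ p) ⟨
  1 + quotient middle∣ * p + a ^ p            ∎)
  where
  open ≡-Reasoning
  term : Vector ℕ (suc p)
  term k = (p C toℕ k) * a ^ toℕ k
  middle : Vector ℕ n
  middle = init (tail term)
  middle∣ : p ∣ Additive.sum middle
  middle∣ = ∣-sum middle λ i →
    ∣m⇒∣m*n _ (prime∣C p-prime (s≤s z≤n) (s≤s (subst (_< n) (sym (toℕ-inject₁ i)) (toℕ<n i))))
  last≡ : last (tail term) ≡ a ^ p
  last≡ = begin
    (p C suc (toℕ (fromℕ n))) * a ^ suc (toℕ (fromℕ n)) ≡⟨ cong (λ j → (p C suc j) * a ^ suc j) (toℕ-fromℕ n) ⟩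
    (p C p) * a ^ p                                     ≡⟨ cong (_* a ^ p) (nCn≡1 p) ⟩
    1 * a ^ p                                           ≡⟨ *-identityˡ (a ^ p) ⟩
    a ^ p ∎

fermat : Prime p → ∀ a → ∃ λ t → a ^ p ≡ a + t * p
fermat {suc _} _ zero = 0 , refl
fermat {p} p-prime (suc a) with freshmans-dream p-prime a | fermat p-prime a
... | m , dream≡ | t , fermat≡ = m + t , (begin
  (1 + a) ^ p            ≡⟨ cong (_^ p) (+-comm 1 a) ⟩
  (a + 1) ^ p            ≡⟨ dream≡ ⟩
  1 + m * p + a ^ p      ≡⟨ cong (1 + m * p +_) fermat≡ ⟩
  1 + m * p + (a + t * p) ≡⟨ lemma a m t p ⟩
  1 + a + (m + t) * p    ∎)
  where
  open ≡-Reasoning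
  lemma : ∀ a m t p → 1 + m * p + (a + t * p) ≡ 1 + a + (m + t) * p
  lemma = solve-∀

module Modular (r : ℕ) .{{_ : NonZero r}} where

  ≈-setoid : Setoid 0ℓ 0ℓ
  ≈-setoid = On.setoid (setoid ℕ) (_% r)

  open Setoid ≈-setoid public using (_≈_)

  +-cong : ∀ {a a′ b b′} → a ≈ a′ → b ≈ b′ → a + b ≈ a′ + b′
  +-cong {a} {a′} {b} {b′} a≈a′ b≈b′ =
    trans (%-distribˡ-+ a b r) (trans (cong₂ (λ u v → (u + v) % r) a≈a′ b≈b′) (sym (%-distribˡ-+ a′ b′ r)))

  *-cong : ∀ {a a′ b b′} → a ≈ a′ → b ≈ b′ → a * b ≈ a′ * b′
  *-cong {a} {a′} {b} {b′} a≈a′ b≈b′ =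
    trans (%-distribˡ-* a b r) (trans (cong₂ (λ u v → (u * v) % r) a≈a′ b≈b′) (sym (%-distribˡ-* a′ b′ r)))

  ^-congˡ : ∀ {a b} k → a ≈ b → a ^ k ≈ b ^ k
  ^-congˡ zero    _   = refl
  ^-congˡ (suc k) a≈b = *-cong a≈b (^-congˡ k a≈b)

-- Unless x ≡ 1, x has order 3 modulo r, whereas Fermat's theorem and r ≡ 2 (mod 3) give x² ≡ x.
prime∣x²+x+1⇒≢2[mod3] : ∀ {r x} → Prime r → r ∣ x * x + x + 1 → r % 3 ≢ 2
prime∣x²+x+1⇒≢2[mod3] {r} {x} r-prime r∣Q r%3≡2 = r≢3 (∣prime⇒≡ prime[3] (prime⇒>1 r-prime) r∣3)
  where
  instance _ = prime⇒nonZero r-prime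
  open Modular r
  open ≈-Reasoning ≈-setoid
  Q = x * x + x + 1
  Q≈0 : Q ≈ 0
  Q≈0 = trans (n∣m⇒m%n≡0 Q r r∣Q) (sym (m*n%n≡0 0 r))
  x³≈1 : x * x * x ≈ 1
  x³≈1 = begin
    x * x * x          ≡⟨ +-identityʳ (x * x * x) ⟨
    x * x * x + 0      ≈⟨ +-cong {x * x * x} refl Q≈0 ⟨
    x * x * x + Q      ≡⟨ lemma x ⟩
    x * Q + 1          ≈⟨ +-cong (*-cong {x} refl Q≈0) refl ⟩
    x * 0 + 1          ≡⟨ cong (_+ 1) (*-zeroʳ x) ⟩
    1                  ∎
    where
    lemma : ∀ x → x * x * x + (x * x + x + 1) ≡ x * (x * x + x + 1) + 1
    lemma = solve-∀
  t = r / 3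
  x^r≈x² : x ^ r ≈ x * x
  x^r≈x² = begin
    x ^ r                      ≡⟨ cong (x ^_) (trans (m≡m%n+[m/n]*n r 3) (cong (_+ t * 3) r%3≡2)) ⟩
    x ^ (2 + t * 3)            ≡⟨ ^-distribˡ-+-* x 2 (t * 3) ⟩
    x ^ 2 * x ^ (t * 3)        ≡⟨ cong₂ _*_ (cong (x *_) (*-identityʳ x)) (trans (cong (x ^_) (*-comm t 3)) (sym (^-*-assoc x 3 t))) ⟩
    x * x * (x ^ 3) ^ t        ≡⟨ cong (λ c → x * x * c ^ t) (trans (cong (x *_) (cong (x *_) (*-identityʳ x))) (sym (*-assoc x x x))) ⟩
    x * x * (x * x * x) ^ t    ≈⟨ *-cong {x * x} refl (^-congˡ t x³≈1) ⟩
    x * x * 1 ^ t              ≡⟨ trans (cong (x * x *_) (^-zeroˡ t)) (*-identityʳ (x * x)) ⟩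
    x * x                      ∎
  x²≈x : x * x ≈ x
  x²≈x with fermat r-prime x
  ... | u , x^r≡ = trans (sym x^r≈x²) (trans (cong (_% r) x^r≡) ([m+kn]%n≡m%n x u r))
  x≈1 : x ≈ 1
  x≈1 = begin
    x              ≈⟨ x²≈x ⟨
    x * x          ≈⟨ *-cong x²≈x refl ⟨
    x * x * x      ≈⟨ x³≈1 ⟩
    1              ∎
  Q≈3 : Q ≈ 3
  Q≈3 = +-cong (+-cong (*-cong x≈1 x≈1) x≈1) refl
  r∣3 : r ∣ 3
  r∣3 = m%n≡0⇒n∣m 3 r (trans (sym Q≈3) (trans Q≈0 (m*n%n≡0 0 r)))
  r≢3 : r ≢ 3
  r≢3 refl = case r%3≡2 of λ ()

prime∣σ[p²]⇒ : Prime p → Prime r → r ∣ σ (p * p) → r ≡ 3 ⊎ r % 3 ≡ 1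
prime∣σ[p²]⇒ {p} {r} p-prime r-prime r∣σ with r % 3 in r%3≡ | m%n<n r 3
... | 0 | _ = inj₁ (sym (∣prime⇒≡ r-prime (s≤s (s≤s z≤n)) (m%n≡0⇒n∣m r 3 r%3≡)))
... | 1 | _ = inj₂ refl
... | 2 | _ = ⊥-elim (prime∣x²+x+1⇒≢2[mod3] {x = p} r-prime (subst (r ∣_) (σ[p²] p-prime) r∣σ) r%3≡)
... | suc (suc (suc _)) | s≤s (s≤s (s≤s ()))

-- Squarefree numbers

squarefree⇒>0 : Squarefree n → 0 < n
squarefree⇒>0 {zero}  sf = ⊥-elim (sf 2 (s≤s (s≤s z≤n)) (4 ∣0))
squarefree⇒>0 {suc _} _  = z<s

squarefree-∣ : m ∣ n → Squarefree n → Squarefree m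
squarefree-∣ m∣n sf d 1<d d²∣m = sf d 1<d (∣-trans d²∣m m∣n)

squarefree-square∣⇒≡1 : Squarefree n → d * d ∣ n → d ≡ 1
squarefree-square∣⇒≡1 {n} {d} sf d²∣n with <-cmp d 1
... | tri< d<1 _ _ = ⊥-elim (<⇒≢ (squarefree⇒>0 sf) (sym (0∣⇒≡0 (subst (λ u → u * u ∣ n) (n<1⇒n≡0 d<1) d²∣n))))
... | tri≈ _ d≡1 _ = d≡1
... | tri> _ _ 1<d = ⊥-elim (sf d 1<d d²∣n)

squarefree-*⇒coprime : Squarefree (m * n) → Coprime m n
squarefree-*⇒coprime sf (d∣m , d∣n) = squarefree-square∣⇒≡1 sf (*-pres-∣ d∣m d∣n)

∃prime∣ : 1 < n → ∃ λ p → Prime p × p ∣ n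
∃prime∣ {n@(suc _)} 1<n with factorise n
... | record { factors = [] ; isFactorisation = n≡1 } = ⊥-elim (<-irrefl (sym n≡1) 1<n)
... | record { factors = p ∷ ps ; isFactorisation = n≡ ; factorsPrime = p-prime ∷ _ } =
  p , p-prime , subst (p ∣_) (sym n≡) (m∣m*n (product ps))

squarefree-induction : (P : ℕ → Set) → P 1 →
  (∀ {p m} → Prime p → Squarefree (p * m) → P m → P (p * m)) →
  ∀ {n} → Squarefree n → P n
squarefree-induction P P1 step {n} = <-rec (λ n → Squarefree n → P n) go n
  where
  go : ∀ n → (∀ {m} → m < n → Squarefree m → P m) → Squarefree n → P n
  go zero    _   sf = ⊥-elim (<-irrefl refl (squarefree⇒>0 sf))
  go (suc zero) _ _ = P1
  go n@(suc (suc _)) rec sf with ∃prime∣ {n} (s≤s (s≤s z≤n))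
  ... | p , p-prime , divides m n≡m*p = subst P (sym n≡p*m) (step p-prime (subst Squarefree n≡p*m sf) (rec m<n m-sf))
    where
    n≡p*m : n ≡ p * m
    n≡p*m = trans n≡m*p (*-comm m p)
    m-sf : Squarefree m
    m-sf = squarefree-∣ (divides p n≡p*m) sf
    m<n : m < n
    m<n = subst (m <_) (sym n≡m*p) (m<m*n m p {{>-nonZero (squarefree⇒>0 m-sf)}} (prime⇒>1 p-prime))

squarefree-one-prime-factor⇒ : Squarefree n → (∀ {p q} → Prime p → Prime q → p ∣ n → q ∣ n → p ≡ q) → n ≡ 1 ⊎ Prime n
squarefree-one-prime-factor⇒ {zero} sf _ = ⊥-elim (<-irrefl refl (squarefree⇒>0 sf))
squarefree-one-prime-factor⇒ {suc zero} _ _ = inj₁ refl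
squarefree-one-prime-factor⇒ {n@(suc (suc _))} sf unique with ∃prime∣ {n} (s≤s (s≤s z≤n))
... | p , p-prime , divides m n≡m*p with <-cmp m 1
...   | tri< m<1 _ _ = ⊥-elim (<-irrefl (sym (trans n≡m*p (cong (_* p) (n<1⇒n≡0 m<1)))) (squarefree⇒>0 sf))
...   | tri≈ _ m≡1 _ = inj₂ (subst Prime (sym (trans n≡m*p (trans (cong (_* p) m≡1) (*-identityˡ p)))) p-prime)
...   | tri> _ _ 1<m with ∃prime∣ 1<m
...     | q , q-prime , q∣m with unique p-prime q-prime (divides m n≡m*p) (∣-trans q∣m (divides p (trans n≡m*p (*-comm m p))))
...       | refl = ⊥-elim (sf p (prime⇒>1 p-prime) (subst (p * p ∣_) (sym n≡m*p) (*-monoˡ-∣ p q∣m)))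

σ-square-* : Coprime a b → σ ((a * b) * (a * b)) ≡ σ (a * a) * σ (b * b)
σ-square-* {a} {b} a⊥b = trans (cong σ (lemma a b)) (σ-* (coprime-*ˡ a⊥b² a⊥b²))
  where
  a⊥b² : Coprime a (b * b)
  a⊥b² = Coprime.sym (coprime-*ˡ (Coprime.sym a⊥b) (Coprime.sym a⊥b))
  lemma : ∀ a b → (a * b) * (a * b) ≡ (a * a) * (b * b)
  lemma = solve-∀

σ[m²]∣σ[n²] : Squarefree n → m ∣ n → σ (m * m) ∣ σ (n * n)
σ[m²]∣σ[n²] {n} {m} sf (divides c n≡c*m) = subst (λ x → σ (m * m) ∣ σ (x * x)) (sym n≡m*c)
  (subst (σ (m * m) ∣_) (sym (σ-square-* {m} {c} (squarefree-*⇒coprime (subst Squarefree n≡m*c sf)))) (m∣m*n _))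
  where
  n≡m*c : n ≡ m * c
  n≡m*c = trans n≡c*m (*-comm c m)

prime∣σ[n²]⇒ : Squarefree n → Prime r → r ∣ σ (n * n) → r ≡ 3 ⊎ r % 3 ≡ 1
prime∣σ[n²]⇒ sf = squarefree-induction (λ n → ∀ {r} → Prime r → r ∣ σ (n * n) → r ≡ 3 ⊎ r % 3 ≡ 1)
  (λ r-prime r∣1 → ⊥-elim (<⇒≢ (prime⇒>1 r-prime) (sym (∣1⇒≡1 r∣1))))
  step sf
  where
  step : ∀ {p m} → Prime p → Squarefree (p * m) → (∀ {r} → Prime r → r ∣ σ (m * m) → r ≡ 3 ⊎ r % 3 ≡ 1) →
    ∀ {r} → Prime r → r ∣ σ ((p * m) * (p * m)) → r ≡ 3 ⊎ r % 3 ≡ 1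
  step {p} {m} p-prime sf ih r-prime r∣σ
    with euclidsLemma (σ (p * p)) (σ (m * m)) r-prime (subst (_ ∣_) (σ-square-* {p} {m} (squarefree-*⇒coprime sf)) r∣σ)
  ... | inj₁ r∣σ[p²] = prime∣σ[p²]⇒ p-prime r-prime r∣σ[p²]
  ... | inj₂ r∣σ[m²] = ih r-prime r∣σ[m²]

two-primes≡1[mod3]⇒9∣σ[n²] : Squarefree n → Prime p → Prime q → p ≢ q → p ∣ n → q ∣ n →
  p % 3 ≡ 1 → q % 3 ≡ 1 → 3 * 3 ∣ σ (n * n)
two-primes≡1[mod3]⇒9∣σ[n²] {n} {p} {q} sf p-prime q-prime p≢q p∣n q∣n p%3≡1 q%3≡1 = ∣-trans
  (subst (3 * 3 ∣_) (sym (σ-square-* {p} {q} p⊥q)) (*-pres-∣ (3∣σ[p²] p-prime p%3≡1) (3∣σ[p²] q-prime q%3≡1)))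
  (σ[m²]∣σ[n²] sf (coprime-∣⇒*∣ p⊥q p∣n q∣n))
  where
  p⊥q = distinct-primes⇒coprime p-prime q-prime p≢q

∣-with-primes≡1[mod3]⇒ : Squarefree n → ¬ 3 * 3 ∣ σ (n * n) → (∀ {r} → Prime r → r ∣ n → r ≡ 3 ⊎ r % 3 ≡ 1) →
  m ∣ n → ¬ 3 ∣ m → m ≡ 1 ⊎ Prime m × m % 3 ≡ 1
∣-with-primes≡1[mod3]⇒ {n} {m} sf 9∤σ primes m∣n 3∤m =
  map₂ (λ m-prime → m-prime , ≡1 m-prime ∣-refl) (squarefree-one-prime-factor⇒ (squarefree-∣ m∣n sf) one-prime)
  where
  ≡1 : ∀ {r} → Prime r → r ∣ m → r % 3 ≡ 1
  ≡1 r-prime r∣m with primes r-prime (∣-trans r∣m m∣n)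
  ... | inj₁ refl  = ⊥-elim (3∤m r∣m)
  ... | inj₂ r%3≡1 = r%3≡1
  one-prime : ∀ {p q} → Prime p → Prime q → p ∣ m → q ∣ m → p ≡ q
  one-prime {p} {q} p-prime q-prime p∣m q∣m with p ≟ q
  ... | yes p≡q = p≡q
  ... | no p≢q = ⊥-elim (9∤σ (two-primes≡1[mod3]⇒9∣σ[n²] sf p-prime q-prime p≢q (∣-trans p∣m m∣n) (∣-trans q∣m m∣n)
                   (≡1 p-prime p∣m) (≡1 q-prime q∣m)))

squarefree-shape : Squarefree n → (∀ {r} → Prime r → r ∣ n → r ≡ 3 ⊎ r % 3 ≡ 1) → ¬ 3 * 3 ∣ σ (n * n) →
  n ≡ 1 ⊎ Prime n ⊎ ∃ λ p → Prime p × p % 3 ≡ 1 × n ≡ 3 * p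
squarefree-shape {n} sf primes 9∤σ with 3 ∣? n
... | no 3∤n = map₂ (inj₁ ∘ proj₁) (∣-with-primes≡1[mod3]⇒ sf 9∤σ primes ∣-refl 3∤n)
... | yes (divides m n≡m*3) with ∣-with-primes≡1[mod3]⇒ sf 9∤σ primes m∣n 3∤m
  where
  n≡3*m : n ≡ 3 * m
  n≡3*m = trans n≡m*3 (*-comm m 3)
  m∣n : m ∣ n
  m∣n = divides 3 n≡3*m
  3∤m : ¬ 3 ∣ m
  3∤m 3∣m = sf 3 (s≤s (s≤s z≤n)) (subst (3 * 3 ∣_) (sym n≡m*3) (*-monoˡ-∣ 3 3∣m))
...   | inj₁ refl = inj₂ (inj₁ (subst Prime (sym n≡m*3) prime[3]))
...   | inj₂ (m-prime , m%3≡1) = inj₂ (inj₂ (m , m-prime , m%3≡1 , trans n≡m*3 (*-comm m 3)))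

-- The system σ(n²) = q^k n, σ(q^k) = 2n

σ[[3p]²]≡m*3p⇒p≡13 : Prime p → p ≢ 3 → σ ((3 * p) * (3 * p)) ≡ m * (3 * p) → p ≡ 13
σ[[3p]²]≡m*3p⇒p≡13 {p} {m} p-prime p≢3 σ≡ with euclidsLemma 13 (σ (p * p)) p-prime p∣13*σ[p²]
  where
  13*σ[p²]≡ : 13 * σ (p * p) ≡ m * (3 * p)
  13*σ[p²]≡ = trans (sym (σ-square-* {3} {p} (distinct-primes⇒coprime prime[3] p-prime (p≢3 ∘ sym)))) σ≡
  p∣13*σ[p²] : p ∣ 13 * σ (p * p)
  p∣13*σ[p²] = subst (p ∣_) (sym 13*σ[p²]≡) (∣n⇒∣m*n m (n∣m*n 3))
... | inj₁ p∣13 = ∣prime⇒≡ prime[13] (prime⇒>1 p-prime) p∣13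
... | inj₂ p∣σ[p²] = ⊥-elim (prime∤σ[p²] p-prime p∣σ[p²])

-- By evaluation, σ (39 * 39) = 61 * 39 and σ 61 = 62.
σ[39²]≡m*39⇒σ[m]≢78 : σ (39 * 39) ≡ m * 39 → σ m ≢ 2 * 39
σ[39²]≡m*39⇒σ[m]≢78 {m} σ≡ with *-cancelʳ-≡ 61 m 39 σ≡
... | refl = λ ()

no-squarefree-solution : Prime q → q ≢ 3 → Squarefree n → σ (n * n) ≡ q ^ k * n → σ (q ^ k) ≡ 2 * n → ⊥
no-squarefree-solution {q} {n} {k} q-prime q≢3 sf σ[n²]≡ σ[q^k]≡ with squarefree-shape sf primes 9∤σ
  where
  9∤σ : ¬ 3 * 3 ∣ σ (n * n)
  9∤σ 9∣σ = sf 3 (s≤s (s≤s z≤n)) (coprime-divisor 9⊥q^k (subst (3 * 3 ∣_) σ[n²]≡ 9∣σ))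
    where
    3⊥q^k : Coprime 3 (q ^ k)
    3⊥q^k = Coprime.sym (coprime-^ˡ k (distinct-primes⇒coprime q-prime prime[3] q≢3))
    9⊥q^k : Coprime (3 * 3) (q ^ k)
    9⊥q^k = coprime-*ˡ 3⊥q^k 3⊥q^k
  primes : ∀ {r} → Prime r → r ∣ n → r ≡ 3 ⊎ r % 3 ≡ 1
  primes r-prime r∣n = prime∣σ[n²]⇒ sf r-prime (subst (_ ∣_) (sym σ[n²]≡) (∣n⇒∣m*n (q ^ k) r∣n))
... | inj₁ refl = case trans (sym (cong σ q^k≡1)) σ[q^k]≡ of λ ()
  where
  q^k≡1 : q ^ k ≡ 1
  q^k≡1 = trans (sym (*-identityʳ (q ^ k))) (sym σ[n²]≡)
... | inj₂ (inj₁ n-prime) = prime∤σ[p²] n-prime (subst (n ∣_) (sym σ[n²]≡) (n∣m*n (q ^ k)))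
... | inj₂ (inj₂ (p , p-prime , p%3≡1 , refl)) with σ[[3p]²]≡m*3p⇒p≡13 {m = q ^ k} p-prime (λ { refl → case p%3≡1 of λ () }) σ[n²]≡
...   | refl = σ[39²]≡m*39⇒σ[m]≢78 {q ^ k} σ[n²]≡ σ[q^k]≡

-- Odd perfect numbers in Eulerian form

gcd[n²,x]∣n⇒s≡n∧x≡cn : ∀ {s c x} → Squarefree s → Coprime s c → 0 < n →
  s * x ≡ c * (n * n) → gcd (n * n) x ∣ n → s ≡ n × x ≡ c * n
gcd[n²,x]∣n⇒s≡n∧x≡cn {n} {s} {c} {x} sf s⊥c 0<n s*x≡ gcd∣n = s≡n , x≡c*n
  where
  instance
    _ = >-nonZero (squarefree⇒>0 sf)
  s∣n² : s ∣ n * n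
  s∣n² = coprime-divisor s⊥c (subst (s ∣_) s*x≡ (m∣m*n x))
  g = quotient s∣n²
  n²≡g*s : n * n ≡ g * s
  n²≡g*s = m∣n⇒n≡quotient*m s∣n²
  instance
    _ = >-nonZero (>0-∣ (*-mono-≤ 0<n 0<n) (divides s (trans n²≡g*s (*-comm g s))))
  x≡c*g : x ≡ c * g
  x≡c*g = *-cancelˡ-≡ x (c * g) s (trans s*x≡ (trans (cong (c *_) n²≡g*s) (lemma c g s)))
    where
    lemma : ∀ c g s → c * (g * s) ≡ s * (c * g)
    lemma = solve-∀
  gcd≡g : gcd (n * n) x ≡ g
  gcd≡g = begin
    gcd (n * n) x          ≡⟨ cong₂ gcd n²≡g*s x≡c*g ⟩
    gcd (g * s) (c * g)    ≡⟨ cong (gcd (g * s)) (*-comm c g) ⟩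
    gcd (g * s) (g * c)    ≡⟨ c*gcd[m,n]≡gcd[cm,cn] g s c ⟨
    g * gcd s c            ≡⟨ cong (g *_) (Coprime.coprime⇒gcd≡1 s⊥c) ⟩
    g * 1                  ≡⟨ *-identityʳ g ⟩
    g                      ∎
    where open ≡-Reasoning
  g∣n : g ∣ n
  g∣n = subst (_∣ n) gcd≡g gcd∣n
  t = quotient g∣n
  n≡t*g : n ≡ t * g
  n≡t*g = m∣n⇒n≡quotient*m g∣n
  t*t*g≡s : t * t * g ≡ s
  t*t*g≡s = *-cancelˡ-≡ (t * t * g) s g (begin
    g * (t * t * g)        ≡⟨ lemma t g ⟩
    (t * g) * (t * g)      ≡⟨ cong (λ u → u * u) n≡t*g ⟨
    n * n                  ≡⟨ n²≡g*s ⟩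
    g * s                  ∎)
    where
    open ≡-Reasoning
    lemma : ∀ t g → g * (t * t * g) ≡ (t * g) * (t * g)
    lemma = solve-∀
  t≡1 : t ≡ 1
  t≡1 = squarefree-square∣⇒≡1 sf (divides g (trans (sym t*t*g≡s) (*-comm (t * t) g)))
  n≡g : n ≡ g
  n≡g = trans n≡t*g (trans (cong (_* g) t≡1) (*-identityˡ g))
  s≡n : s ≡ n
  s≡n = trans (sym t*t*g≡s) (trans (cong (λ u → u * u * g) t≡1) (trans (*-identityˡ g) (sym n≡g)))
  x≡c*n : x ≡ c * n
  x≡c*n = trans x≡c*g (cong (c *_) (sym n≡g))

%4≡1⇒%2≡1 : ∀ n → n % 4 ≡ 1 → n % 2 ≡ 1
%4≡1⇒%2≡1 n n%4≡1 = trans (sym (m∣n⇒o%n%m≡o%m 2 4 n (divides 2 refl))) (cong (_% 2) n%4≡1)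

perfect⇒s*σ[n²]≡q^k*n² : ∀ {s} → Coprime q n → σ (q ^ k * (n * n)) ≡ 2 * (q ^ k * (n * n)) →
  σ (q ^ k) ≡ 2 * s → s * σ (n * n) ≡ q ^ k * (n * n)
perfect⇒s*σ[n²]≡q^k*n² {q} {n} {k} {s} q⊥n σN≡2N σ[q^k]≡2s = *-cancelˡ-≡ _ _ 2 (begin
  2 * (s * σ (n * n))     ≡⟨ *-assoc 2 s (σ (n * n)) ⟨
  2 * s * σ (n * n)       ≡⟨ cong (_* σ (n * n)) σ[q^k]≡2s ⟨
  σ (q ^ k) * σ (n * n)   ≡⟨ σ-* q^k⊥n² ⟨
  σ (q ^ k * (n * n))     ≡⟨ σN≡2N ⟩
  2 * (q ^ k * (n * n))   ∎)
  where
  open ≡-Reasoning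
  n⊥q = Coprime.sym q⊥n
  q^k⊥n² : Coprime (q ^ k) (n * n)
  q^k⊥n² = coprime-^ˡ k (Coprime.sym (coprime-*ˡ n⊥q n⊥q))

theorem3 : (N q k n : ℕ) → EulerianOPN N q k n →
    Squarefree (σ (q ^ k) / 2) →
    (J : ℕ) → gcd (n * n) (σ (n * n)) ≡ J * gcd n (σ (n * n)) → J ≢ 1
theorem3 N q k n ((_ , σN≡2N) , _ , refl , q-prime , _ , 0<n , q%4≡1 , k%4≡1 , gcd[q,n]≡1) s-sf J H≡J*I refl =
  no-squarefree-solution {k = k} q-prime q≢3 (subst Squarefree s≡n s-sf) σ[n²]≡q^k*n
    (trans σ[q^k]≡2s (cong (2 *_) s≡n))
  where
  s = σ (q ^ k) / 2
  q≢3 : q ≢ 3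
  q≢3 refl = case q%4≡1 of λ ()
  σ[q^k]≡2s : σ (q ^ k) ≡ 2 * s
  σ[q^k]≡2s = sym (m*[n/m]≡n (2∣σ[p^k] {k = k} q-prime (%4≡1⇒%2≡1 q q%4≡1) (%4≡1⇒%2≡1 k k%4≡1)))
  H∣n : gcd (n * n) (σ (n * n)) ∣ n
  H∣n = subst (_∣ n) (sym (trans H≡J*I (*-identityˡ _))) (gcd[m,n]∣m n (σ (n * n)))
  cofactor : s ≡ n × σ (n * n) ≡ q ^ k * n
  cofactor = gcd[n²,x]∣n⇒s≡n∧x≡cn s-sf (∣σ[p^k]⇒coprime {k = k} q-prime (divides 2 σ[q^k]≡2s)) 0<n
    (perfect⇒s*σ[n²]≡q^k*n² {q = q} {n = n} {k = k} {s = s} (Coprime.gcd≡1⇒coprime gcd[q,n]≡1) σN≡2N σ[q^k]≡2s) H∣n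
  s≡n = proj₁ cofactor
  σ[n²]≡q^k*n = proj₂ cofactor
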